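{- Let $V$ be a quasivariety and let $X$ be a maximal element of $V$. Then $\overline{X}\le_e X$, where $\overline{X}=I\setminus X$.
   Context: $I$ is a computable countable set identified with $\mathbb{N}$. A quasivariety $V$ is given by a recursively enumerable set $S$ of finite sequences $(n_0,\dots,n_k)$ of elements of $I$: $V$ is the set of all $X\subseteq I$ such that for every $(n_0,\dots,n_k)\in S$, if $n_1,\dots,n_k\in X$ then $n_0\in X$. An element $X\in V$ is maximal if whenever $Y\in V$ and $X\subseteq Y$, then $Y=X$ or $Y=I$. Enumeration reducibility: $A\le_e B$ means there is a computable $f: I\times\mathbb{N}\to P_f(I)\cup\{\{\bot\}\}$ (with $P_f(I)$ a recursive encoding of finite subsets of $I$, $\bot\notin I$) such that for all $x$: $x\in A\iff \exists n,\ f(x,n)\subseteq B$. -}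

module Defs where

open import Level using (0ℓ)
open import Data.Nat using (ℕ; zero; suc; _+_; _*_; _<_; _/_; _%_)
open import Data.Fin using (Fin)
open import Data.Vec using (Vec; []; _∷_; lookup)
open import Data.List using (List; []; _∷_)
open import Data.List.Relation.Unary.All using (All)
open import Data.Product using (Σ; _×_; ∃)
open import Data.Sum using (_⊎_)
open import Data.Empty using (⊥)
open import Relation.Unary using (Pred; _⊆_)
open import Relation.Binary.PropositionalEquality using (_≡_)
open import Function.Bundles using (_⇔_)

data PR : ℕ → Set where
  zeroF : ∀ {n} → PR n
  succF : PR 1
  projF : ∀ {n} → Fin n → PR n
  compF : ∀ {m n} → PR m → Vec (PR n) m → PR n
  recF  : ∀ {n} → PR n → PR (suc (suc n)) → PR (suc n)
  minF  : ∀ {n} → PR (suc n) → PR n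

mutual
  data Eval : ∀ {n} → PR n → Vec ℕ n → ℕ → Set where
    evZero : ∀ {n} {xs : Vec ℕ n} → Eval zeroF xs 0
    evSucc : ∀ {x} → Eval succF (x ∷ []) (suc x)
    evProj : ∀ {n} {i : Fin n} {xs} → Eval (projF i) xs (lookup xs i)
    evComp : ∀ {m n} {f : PR m} {gs : Vec (PR n) m} {xs ys y} →
             EvalAll gs xs ys → Eval f ys y → Eval (compF f gs) xs y
    evRec0 : ∀ {n} {f : PR n} {g} {xs y} →
             Eval f xs y → Eval (recF f g) (0 ∷ xs) y
    evRecS : ∀ {n} {f : PR n} {g} {k xs z y} →
             Eval (recF f g) (k ∷ xs) z → Eval g (k ∷ z ∷ xs) y →
             Eval (recF f g) (suc k ∷ xs) y
    evMin  : ∀ {n} {f : PR (suc n)} {xs y} →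
             Eval f (y ∷ xs) 0 →
             (∀ z → z < y → Σ ℕ (λ w → Eval f (z ∷ xs) (suc w))) →
             Eval (minF f) xs y

  data EvalAll : ∀ {m n} → Vec (PR n) m → Vec ℕ n → Vec ℕ m → Set where
    evNil  : ∀ {n} {xs : Vec ℕ n} → EvalAll [] xs []
    evCons : ∀ {m n} {g : PR n} {gs : Vec (PR n) m} {xs y ys} →
             Eval g xs y → EvalAll gs xs ys → EvalAll (g ∷ gs) xs (y ∷ ys)

Computable₂ : (ℕ → ℕ → ℕ) → Set
Computable₂ f = Σ (PR 2) λ c → ∀ x n → Eval c (x ∷ n ∷ []) (f x n)

-- Coding of finite sequences of naturals (Cantor pairing, a bijection
-- List ℕ ≅ ℕ).

tri : ℕ → ℕ
tri zero    = 0
tri (suc n) = suc n + tri n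

pair : ℕ → ℕ → ℕ
pair x y = tri (x + y) + y

codeList : List ℕ → ℕ
codeList []       = 0
codeList (x ∷ xs) = suc (pair x (codeList xs))

-- W_e : the domain of the partial recursive function with code e
-- (a set of naturals is r.e. iff it is some W_e)
RE : Pred ℕ 0ℓ → Set
RE A = Σ (PR 1) λ e → ∀ m → A m ⇔ ∃ (λ y → Eval e (m ∷ []) y)

-- Quasivarieties.  The index set I is ℕ.  A set of finite sequences
-- (n₀, n₁, …, n_k) is a predicate S n₀ [n₁,…,n_k].

SeqSet : Set₁
SeqSet = ℕ → List ℕ → Set

REseq : SeqSet → Set
REseq S = Σ (PR 1) λ e → ∀ n₀ ns →
  S n₀ ns ⇔ ∃ (λ y → Eval e (codeList (n₀ ∷ ns) ∷ []) y)

InV : SeqSet → Pred ℕ 0ℓ → Set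
InV S X = ∀ n₀ ns → S n₀ ns → All X ns → X n₀

Maximal : SeqSet → Pred ℕ 0ℓ → Set₁
Maximal S X = InV S X ×
  (∀ (Y : Pred ℕ 0ℓ) → InV S Y → X ⊆ Y → (Y ⊆ X) ⊎ (∀ i → Y i))

-- Recursive encoding of P_f(I) ∪ {{⊥}} by ℕ:
--   code 0       ↦ {⊥}
--   code (suc u) ↦ D_u = { i | the i-th binary digit of u is 1 }

bit : ℕ → ℕ → ℕ
bit zero    u = u % 2
bit (suc i) u = bit i (u / 2)

-- the finite set (or {⊥}) coded by c is contained in B  (⊥ ∉ B ⊆ I)
_⊆code_ : ℕ → Pred ℕ 0ℓ → Set
zero  ⊆code B = ⊥
suc u ⊆code B = ∀ i → bit i u ≡ 1 → B i

_≤e_ : Pred ℕ 0ℓ → Pred ℕ 0ℓ → Set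
A ≤e B = Σ (ℕ → ℕ → ℕ) λ f → Computable₂ f ×
           (∀ x → A x ⇔ ∃ (λ n → f x n ⊆code B))

∁ : Pred ℕ 0ℓ → Pred ℕ 0ℓ
∁ X x = X x → ⊥

-- Fix a ∉ X; if there is none, ∁ X is empty. By maximality, x ∉ X exactly when a is derivable
-- by the rules S from X ∪ {x}: this closure lies in V and contains x, so it is all of I, whereas
-- for x ∈ X it is contained in X. A derivation is finite, so x ∉ X iff there are a finite D ⊆ X,
-- a list of rule instances deriving a from D ∪ {x}, and a clock t within which the enumeration
-- of S accepts each of them. Given D, checking such a witness is computable: it needs bounded
-- loops over codes of lists and a clocked evaluator for μ-recursive codes, which is computable
-- and agrees with Eval once the clock is large enough.

module Submission where

open import Defs
open import Level using (0ℓ)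
open import Axiom.ExcludedMiddle using (ExcludedMiddle)
open import Data.Nat using (ℕ; zero; suc; _+_; _*_; _∸_; _≤_; _<_; z≤n; s≤s; pred; _/_; _%_)
open import Data.Nat.Properties
open import Data.Nat.DivMod
open import Data.Vec using (Vec; []; _∷_; lookup; tabulate; map)
import Data.Vec as Vec
open import Data.Vec.Properties using (tabulate∘lookup)
open import Data.List using (List; []; _∷_; drop; length; _++_)
import Data.List as L
open import Data.List.Properties using (drop-map; map-++; length-map)
open import Data.List.Relation.Unary.All using (All; []; _∷_)
import Data.List.Relation.Unary.All as All
open import Data.List.Relation.Unary.Any using (here; there)
open import Data.List.Membership.Propositional using (_∈_)
open import Data.List.Membership.Propositional.Properties using (∈-++⁺ˡ; ∈-++⁺ʳ)
open import Data.Fin using (Fin; zero; suc; #_; _↑ʳ_)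
open import Data.Product using (Σ; _,_; proj₁; proj₂; _×_; ∃)
open import Data.Sum using (_⊎_; inj₁; inj₂)
import Data.Sum as Sum
open import Data.Empty using (⊥; ⊥-elim)
open import Data.Unit using (⊤; tt)
open import Function using (_∘_)
open import Function.Bundles using (_⇔_; mk⇔; Equivalence)
open import Function.Construct.Composition using (_⇔-∘_)
open import Relation.Nullary using (¬_; Dec; yes; no)
open import Relation.Unary using (Pred; _⊆_; _∪_; ｛_｝)
open import Relation.Binary.PropositionalEquality
open import Relation.Binary.Definitions using (tri<; tri≈; tri>)

-- Computable functions

Computable : ∀ n → (Vec ℕ n → ℕ) → Set
Computable n F = Σ (PR n) λ c → ∀ xs → Eval c xs (F xs)

Computable* : ∀ n m → (Vec ℕ n → Vec ℕ m) → Set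
Computable* n m G = Σ (Vec (PR n) m) λ cs → ∀ xs → EvalAll cs xs (G xs)

Computable-resp : ∀ {n} {F G : Vec ℕ n → ℕ} → Computable n F → F ≗ G → Computable n G
Computable-resp (c , p) F≗G = c , λ xs → subst (Eval c xs) (F≗G xs) (p xs)

Computable*-resp : ∀ {n m} {F G : Vec ℕ n → Vec ℕ m} → Computable* n m F → F ≗ G → Computable* n m G
Computable*-resp (c , p) F≗G = c , λ xs → subst (EvalAll c xs) (F≗G xs) (p xs)

[]ᶜ : ∀ {n} → Computable* n 0 (λ _ → [])
[]ᶜ = [] , λ xs → evNil

infixr 5 _∷ᶜ_
_∷ᶜ_ : ∀ {n m F G} → Computable n F → Computable* n m G → Computable* n (suc m) (λ xs → F xs ∷ G xs)
(c , p) ∷ᶜ (cs , q) = (c ∷ cs) , λ xs → evCons (p xs) (q xs)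

compᶜ : ∀ {n m F G} → Computable m F → Computable* n m G → Computable n (F ∘ G)
compᶜ {G = G} (c , p) (cs , q) = compF c cs , λ xs → evComp (q xs) (p (G xs))

zeroᶜ : ∀ {n} → Computable n (λ _ → 0)
zeroᶜ = zeroF , λ xs → evZero

sucᶜ : Computable 1 (λ xs → suc (lookup xs zero))
sucᶜ = succF , λ { (x ∷ []) → evSucc }

projᶜ : ∀ {n} (i : Fin n) → Computable n (λ xs → lookup xs i)
projᶜ i = projF i , λ xs → evProj

constᶜ : ∀ {n} (k : ℕ) → Computable n (λ _ → k)
constᶜ zero    = zeroᶜ
constᶜ (suc k) = compᶜ sucᶜ (constᶜ k ∷ᶜ []ᶜ)

recᶜ : ∀ {n F G} {h : Vec ℕ (suc n) → ℕ} → Computable n F → Computable (suc (suc n)) G →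
       (∀ xs → h (0 ∷ xs) ≡ F xs) → (∀ k xs → h (suc k ∷ xs) ≡ G (k ∷ h (k ∷ xs) ∷ xs)) →
       Computable (suc n) h
recᶜ {h = h} (f , p) (g , q) h-zero h-suc = recF f g , eval
  where
  eval : ∀ xs → Eval (recF f g) xs (h xs)
  eval (zero ∷ xs)  = subst (Eval _ _) (sym (h-zero xs)) (evRec0 (p xs))
  eval (suc k ∷ xs) = subst (Eval _ _) (sym (h-suc k xs)) (evRecS (eval (k ∷ xs)) (q _))

projsᶜ : ∀ {n m} (f : Fin m → Fin n) → Computable* n m (λ xs → tabulate (λ i → lookup xs (f i)))
projsᶜ {m = zero}  f = []ᶜ
projsᶜ {m = suc m} f = projᶜ (f zero) ∷ᶜ projsᶜ (f ∘ suc)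

idᶜ : ∀ {n} → Computable* n n (λ xs → xs)
idᶜ = Computable*-resp (projsᶜ (λ i → i)) tabulate∘lookup

dropᶜ : ∀ k {n} → Computable* (k + n) n (Vec.drop k)
dropᶜ k = Computable*-resp (projsᶜ (k ↑ʳ_)) (tabulate-lookup-↑ʳ k)
  where
  tabulate-lookup-↑ʳ : ∀ k {n} (xs : Vec ℕ (k + n)) → tabulate (λ i → lookup xs (k ↑ʳ i)) ≡ Vec.drop k xs
  tabulate-lookup-↑ʳ zero    xs       = tabulate∘lookup xs
  tabulate-lookup-↑ʳ (suc k) (_ ∷ xs) = tabulate-lookup-↑ʳ k xs

compᶜ* : ∀ {n m k} {G : Vec ℕ m → Vec ℕ k} {H : Vec ℕ n → Vec ℕ m} →
         Computable* m k G → Computable* n m H → Computable* n k (G ∘ H)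
compᶜ* {k = zero}  {G} {H} _ _ = Computable*-resp []ᶜ (λ xs → Vec-0-unique (G (H xs)))
  where
  Vec-0-unique : (w : Vec ℕ 0) → [] ≡ w
  Vec-0-unique [] = refl
compᶜ* {k = suc k} {G} {H} (c ∷ cs , p) q =
  Computable*-resp (compᶜ (c , eval-head ∘ p) q ∷ᶜ compᶜ* (cs , eval-tail ∘ p) q) (λ xs → η (G (H xs)))
  where
  eval-head : ∀ {xs ys} → EvalAll (c ∷ cs) xs ys → Eval c xs (Vec.head ys)
  eval-head (evCons e _) = e
  eval-tail : ∀ {xs ys} → EvalAll (c ∷ cs) xs ys → EvalAll cs xs (Vec.tail ys)
  eval-tail (evCons _ es) = es
  η : (w : Vec ℕ (suc k)) → Vec.head w ∷ Vec.tail w ≡ w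
  η (_ ∷ _) = refl

-- Truth values are naturals, with 0 as false and every nonzero value as true.

NZ : ℕ → Set
NZ n = ¬ n ≡ 0

guard : ℕ → ℕ → ℕ
guard zero    b = 0
guard (suc _) b = b

orN : ℕ → ℕ → ℕ
orN zero    b = b
orN (suc a) b = suc a

allBelow : ℕ → (ℕ → ℕ) → ℕ
allBelow zero    P = 1
allBelow (suc k) P = guard (allBelow k P) (P k)

anyBelow : ℕ → (ℕ → ℕ) → ℕ
anyBelow zero    P = 0
anyBelow (suc k) P = orN (anyBelow k P) (P k)

guard⁻ˡ : ∀ a b → NZ (guard a b) → NZ a
guard⁻ˡ zero    b h = λ _ → h refl
guard⁻ˡ (suc a) b h = λ ()

guard⁻ʳ : ∀ a b → NZ (guard a b) → NZ b
guard⁻ʳ zero    b h = ⊥-elim (h refl)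
guard⁻ʳ (suc a) b h = h

guard⁺ : ∀ a b → NZ a → NZ b → NZ (guard a b)
guard⁺ zero    b ha hb = ⊥-elim (ha refl)
guard⁺ (suc a) b ha hb = hb

orN⁻ : ∀ a b → NZ (orN a b) → NZ a ⊎ NZ b
orN⁻ zero    b h = inj₂ h
orN⁻ (suc a) b h = inj₁ (λ ())

orN⁺ˡ : ∀ a b → NZ a → NZ (orN a b)
orN⁺ˡ zero    b h = ⊥-elim (h refl)
orN⁺ˡ (suc a) b h = λ ()

orN⁺ʳ : ∀ a b → NZ b → NZ (orN a b)
orN⁺ʳ zero    b h = h
orN⁺ʳ (suc a) b h = λ ()

allBelow⁻ : ∀ B P → NZ (allBelow B P) → ∀ k → k < B → NZ (P k)
allBelow⁻ (suc B) P h k (s≤s k≤B) with m≤n⇒m<n∨m≡n k≤B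
... | inj₁ k<B = allBelow⁻ B P (guard⁻ˡ _ _ h) k k<B
... | inj₂ refl = guard⁻ʳ _ _ h

allBelow⁺ : ∀ B P → (∀ k → k < B → NZ (P k)) → NZ (allBelow B P)
allBelow⁺ zero    P h = λ ()
allBelow⁺ (suc B) P h = guard⁺ _ _ (allBelow⁺ B P (λ k k<B → h k (≤-trans k<B (n≤1+n B)))) (h B ≤-refl)

anyBelow⁻ : ∀ B P → NZ (anyBelow B P) → Σ ℕ λ k → k < B × NZ (P k)
anyBelow⁻ zero    P h = ⊥-elim (h refl)
anyBelow⁻ (suc B) P h with orN⁻ _ _ h
... | inj₁ h′ = let (k , k<B , Pk) = anyBelow⁻ B P h′ in k , ≤-trans k<B (n≤1+n B) , Pk
... | inj₂ h′ = B , ≤-refl , h′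

anyBelow⁺ : ∀ B P k → k < B → NZ (P k) → NZ (anyBelow B P)
anyBelow⁺ (suc B) P k (s≤s k≤B) h with m≤n⇒m<n∨m≡n k≤B
... | inj₁ k<B = orN⁺ˡ _ _ (anyBelow⁺ B P k k<B h)
... | inj₂ refl = orN⁺ʳ _ _ h

guardᶜ : Computable 2 (λ xs → guard (lookup xs zero) (lookup xs (# 1)))
guardᶜ = recᶜ zeroᶜ (projᶜ (# 2)) (λ _ → refl) (λ _ _ → refl)

orᶜ : Computable 2 (λ xs → orN (lookup xs zero) (lookup xs (# 1)))
orᶜ = recᶜ (projᶜ zero) (compᶜ sucᶜ (projᶜ zero ∷ᶜ []ᶜ)) (λ _ → refl) (λ _ _ → refl)

allBelowᶜ : ∀ {n} {P : Vec ℕ (suc n) → ℕ} → Computable (suc n) P →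
            Computable (suc n) (λ xs → allBelow (lookup xs zero) (λ j → P (j ∷ Vec.drop 1 xs)))
allBelowᶜ P = recᶜ (constᶜ 1) (compᶜ guardᶜ (projᶜ (# 1) ∷ᶜ compᶜ P (projᶜ zero ∷ᶜ dropᶜ 2) ∷ᶜ []ᶜ))
                   (λ _ → refl) (λ _ _ → refl)

anyBelowᶜ : ∀ {n} {P : Vec ℕ (suc n) → ℕ} → Computable (suc n) P →
            Computable (suc n) (λ xs → anyBelow (lookup xs zero) (λ j → P (j ∷ Vec.drop 1 xs)))
anyBelowᶜ P = recᶜ zeroᶜ (compᶜ orᶜ (projᶜ (# 1) ∷ᶜ compᶜ P (projᶜ zero ∷ᶜ dropᶜ 2) ∷ᶜ []ᶜ))
                   (λ _ → refl) (λ _ _ → refl)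

-- A small expression language whose denotations are computable by construction

CompFn : ℕ → Set
CompFn m = Σ (Vec ℕ m → ℕ) (Computable m)

data Expr (n : ℕ) : Set where
  var  : Fin n → Expr n
  lit  : ℕ → Expr n
  app  : ∀ {m} → CompFn m → Vec (Expr n) m → Expr n
  all< : Expr n → Expr (suc n) → Expr n
  any< : Expr n → Expr (suc n) → Expr n

mutual
  ⟦_⟧ : ∀ {n} → Expr n → Vec ℕ n → ℕ
  ⟦ var i ⟧      ρ = lookup ρ i
  ⟦ lit c ⟧      ρ = c
  ⟦ app (F , _) es ⟧ ρ = F (⟦ es ⟧* ρ)
  ⟦ all< b e ⟧   ρ = allBelow (⟦ b ⟧ ρ) (λ j → ⟦ e ⟧ (j ∷ ρ))
  ⟦ any< b e ⟧   ρ = anyBelow (⟦ b ⟧ ρ) (λ j → ⟦ e ⟧ (j ∷ ρ))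

  ⟦_⟧* : ∀ {n m} → Vec (Expr n) m → Vec ℕ n → Vec ℕ m
  ⟦ [] ⟧*     ρ = []
  ⟦ e ∷ es ⟧* ρ = ⟦ e ⟧ ρ ∷ ⟦ es ⟧* ρ

mutual
  compile : ∀ {n} (e : Expr n) → Computable n ⟦ e ⟧
  compile (var i)           = projᶜ i
  compile (lit c)           = constᶜ c
  compile (app (F , cf) es) = compᶜ cf (compile* es)
  compile (all< b e)        = compᶜ (allBelowᶜ (compile e)) (compile b ∷ᶜ idᶜ)
  compile (any< b e)        = compᶜ (anyBelowᶜ (compile e)) (compile b ∷ᶜ idᶜ)

  compile* : ∀ {n m} (es : Vec (Expr n) m) → Computable* n m ⟦ es ⟧*
  compile* []       = []ᶜ
  compile* (e ∷ es) = compile e ∷ᶜ compile* es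

app₁ : ∀ {n} → CompFn 1 → Expr n → Expr n
app₁ f a = app f (a ∷ [])

app₂ : ∀ {n} → CompFn 2 → Expr n → Expr n → Expr n
app₂ f a b = app f (a ∷ b ∷ [])

app₃ : ∀ {n} → CompFn 3 → Expr n → Expr n → Expr n → Expr n
app₃ f a b c = app f (a ∷ b ∷ c ∷ [])

app₄ : ∀ {n} → CompFn 4 → Expr n → Expr n → Expr n → Expr n → Expr n
app₄ f a b c d = app f (a ∷ b ∷ c ∷ d ∷ [])

sucᶠ : CompFn 1
sucᶠ = _ , sucᶜ

predᶠ : CompFn 1
predᶠ = (λ xs → pred (lookup xs zero)) , recᶜ zeroᶜ (projᶜ zero) (λ _ → refl) (λ _ _ → refl)

+ᶠ : CompFn 2
+ᶠ = (λ xs → lookup xs zero + lookup xs (# 1)) ,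
  recᶜ (projᶜ zero) (compᶜ sucᶜ (projᶜ (# 1) ∷ᶜ []ᶜ)) (λ _ → refl) (λ _ _ → refl)

∸ᶠ : CompFn 2
∸ᶠ = (λ xs → lookup xs zero ∸ lookup xs (# 1)) ,
  compᶜ (recᶜ {h = λ xs → lookup xs (# 1) ∸ lookup xs zero}
              (projᶜ zero) (compᶜ (proj₂ predᶠ) (projᶜ (# 1) ∷ᶜ []ᶜ))
              (λ _ → refl) (λ { b (a ∷ []) → sym (pred[m∸n]≡m∸[1+n] a b) }))
        (projᶜ (# 1) ∷ᶜ projᶜ zero ∷ᶜ []ᶜ)

isZero : ℕ → ℕ
isZero zero    = 1
isZero (suc _) = 0

isZeroᶠ : CompFn 1
isZeroᶠ = (λ xs → isZero (lookup xs zero)) , recᶜ (constᶜ 1) zeroᶜ (λ _ → refl) (λ _ _ → refl)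

guardᶠ : CompFn 2
guardᶠ = _ , guardᶜ

orᶠ : CompFn 2
orᶠ = _ , orᶜ

ifz : ℕ → ℕ → ℕ → ℕ
ifz zero    a b = a
ifz (suc _) a b = b

ifzᶠ : CompFn 3
ifzᶠ = (λ xs → ifz (lookup xs zero) (lookup xs (# 1)) (lookup xs (# 2))) ,
  recᶜ (projᶜ zero) (projᶜ (# 3)) (λ _ → refl) (λ _ _ → refl)

eqN : ℕ → ℕ → ℕ
eqN a b = isZero ((a ∸ b) + (b ∸ a))

eqᶠ : CompFn 2
eqᶠ = (λ xs → eqN (lookup xs zero) (lookup xs (# 1))) ,
  compile (app₁ isZeroᶠ (app₂ +ᶠ (app₂ ∸ᶠ (var zero) (var (# 1))) (app₂ ∸ᶠ (var (# 1)) (var zero))))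

eqN-refl : ∀ a → eqN a a ≡ 1
eqN-refl a rewrite n∸n≡0 a = refl

eqN⇒≡ : ∀ a b → NZ (eqN a b) → a ≡ b
eqN⇒≡ zero    zero    _ = refl
eqN⇒≡ zero    (suc b) h = ⊥-elim (h refl)
eqN⇒≡ (suc a) zero    h = ⊥-elim (h (cong isZero (+-comm (suc a) 0)))
eqN⇒≡ (suc a) (suc b) h = cong suc (eqN⇒≡ a b h)

-- Cantor pairing and codes of lists

triᶠ : CompFn 1
triᶠ = (λ xs → tri (lookup xs zero)) ,
  recᶜ zeroᶜ (compile (app₂ +ᶠ (app₁ sucᶠ (var zero)) (var (# 1)))) (λ _ → refl) (λ _ _ → refl)

diagonalStep : ℕ → ℕ → ℕ
diagonalStep n s = ifz (tri (suc s) ∸ suc n) (suc s) s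

diagonal : ℕ → ℕ
diagonal zero    = 0
diagonal (suc n) = diagonalStep n (diagonal n)

diagonalᶠ : CompFn 1
diagonalᶠ = (λ xs → diagonal (lookup xs zero)) ,
  recᶜ zeroᶜ (compile (app₃ ifzᶠ (app₂ ∸ᶠ (app₁ triᶠ (app₁ sucᶠ (var (# 1)))) (app₁ sucᶠ (var zero)))
                                (app₁ sucᶠ (var (# 1))) (var (# 1))))
       (λ _ → refl) (λ _ _ → refl)

unpair₂ : ℕ → ℕ
unpair₂ n = n ∸ tri (diagonal n)

unpair₁ : ℕ → ℕ
unpair₁ n = diagonal n ∸ unpair₂ n

unpair₂ᶠ : CompFn 1
unpair₂ᶠ = (λ xs → unpair₂ (lookup xs zero)) ,
  compile (app₂ ∸ᶠ (var zero) (app₁ triᶠ (app₁ diagonalᶠ (var zero))))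

unpair₁ᶠ : CompFn 1
unpair₁ᶠ = (λ xs → unpair₁ (lookup xs zero)) ,
  compile (app₂ ∸ᶠ (app₁ diagonalᶠ (var zero)) (app₁ unpair₂ᶠ (var zero)))

diagonal-spec : ∀ n → tri (diagonal n) ≤ n × n < tri (suc (diagonal n))
diagonal-spec zero = z≤n , s≤s z≤n
diagonal-spec (suc n) with diagonal-spec n
... | lo , hi with tri (suc (diagonal n)) ∸ suc n in eq
... | zero  = m∸n≡0⇒m≤n eq , s≤s (≤-trans hi (m≤n+m (tri (suc (diagonal n))) (suc (diagonal n))))
... | suc k = ≤-trans lo (n≤1+n n) , m∸n≢0⇒n<m (λ e → 1+n≢0 (trans (sym eq) e))

tri-mono-≤ : ∀ {a b} → a ≤ b → tri a ≤ tri b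
tri-mono-≤ {zero}  {b}     _         = z≤n
tri-mono-≤ {suc a} {suc b} (s≤s a≤b) = +-mono-≤ (s≤s a≤b) (tri-mono-≤ a≤b)

diagonal-unique : ∀ s n → tri s ≤ n → n < tri (suc s) → diagonal n ≡ s
diagonal-unique s n lo hi with <-cmp (diagonal n) s | diagonal-spec n
... | tri≈ _ e _  | _         = e
... | tri< lt _ _ | (_ , hi′) = ⊥-elim (<-irrefl refl (<-≤-trans hi′ (≤-trans (tri-mono-≤ lt) lo)))
... | tri> _ _ gt | (lo′ , _) = ⊥-elim (<-irrefl refl (<-≤-trans hi (≤-trans (tri-mono-≤ gt) lo′)))

diagonal-pair : ∀ a b → diagonal (pair a b) ≡ a + b
diagonal-pair a b = diagonal-unique (a + b) (pair a b) (m≤m+n _ _)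
  (subst (_< tri (suc (a + b))) (+-comm b (tri (a + b)))
    (+-monoˡ-< (tri (a + b)) (s≤s (m≤n+m b a))))

unpair₂-pair : ∀ a b → unpair₂ (pair a b) ≡ b
unpair₂-pair a b rewrite diagonal-pair a b = m+n∸m≡n (tri (a + b)) b

unpair₁-pair : ∀ a b → unpair₁ (pair a b) ≡ a
unpair₁-pair a b rewrite unpair₂-pair a b | diagonal-pair a b = m+n∸n≡m a b

unpair₂≤diagonal : ∀ n → unpair₂ n ≤ diagonal n
unpair₂≤diagonal n with diagonal-spec n
... | lo , hi = ≤-pred (subst (unpair₂ n <_) (m+n∸n≡m (suc (diagonal n)) (tri (diagonal n))) (∸-monoˡ-< hi lo))

pair-unpair : ∀ n → pair (unpair₁ n) (unpair₂ n) ≡ n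
pair-unpair n = begin
  tri (unpair₁ n + unpair₂ n) + unpair₂ n
    ≡⟨ cong (λ s → tri s + unpair₂ n) (m∸n+n≡m (unpair₂≤diagonal n)) ⟩
  tri (diagonal n) + (n ∸ tri (diagonal n))
    ≡⟨ m+[n∸m]≡n (proj₁ (diagonal-spec n)) ⟩
  n ∎
  where open ≡-Reasoning

unpair₂≤ : ∀ n → unpair₂ n ≤ n
unpair₂≤ n = m∸n≤m n (tri (diagonal n))

hd : ℕ → ℕ
hd l = unpair₁ (pred l)

tl : ℕ → ℕ
tl l = unpair₂ (pred l)

hdᶠ : CompFn 1
hdᶠ = (λ xs → hd (lookup xs zero)) , compile (app₁ unpair₁ᶠ (app₁ predᶠ (var zero)))

tlᶠ : CompFn 1
tlᶠ = (λ xs → tl (lookup xs zero)) , compile (app₁ unpair₂ᶠ (app₁ predᶠ (var zero)))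

hd-codeList : ∀ y ys → hd (codeList (y ∷ ys)) ≡ y
hd-codeList y ys = unpair₁-pair y (codeList ys)

tl-codeList : ∀ y ys → tl (codeList (y ∷ ys)) ≡ codeList ys
tl-codeList y ys = unpair₂-pair y (codeList ys)

tl≤pred : ∀ l → tl l ≤ pred l
tl≤pred l = unpair₂≤ (pred l)

tl< : ∀ l → NZ l → tl l < l
tl< zero    h = ⊥-elim (h refl)
tl< (suc l) h = s≤s (tl≤pred (suc l))

suffix : ℕ → ℕ → ℕ
suffix l zero    = l
suffix l (suc k) = tl (suffix l k)

suffixᶠ : CompFn 2
suffixᶠ = (λ xs → suffix (lookup xs zero) (lookup xs (# 1))) ,
  compᶜ (recᶜ {h = λ xs → suffix (lookup xs (# 1)) (lookup xs zero)}
              (projᶜ zero) (compᶜ (proj₂ tlᶠ) (projᶜ (# 1) ∷ᶜ []ᶜ)) (λ _ → refl) (λ _ _ → refl))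
        (projᶜ (# 1) ∷ᶜ projᶜ zero ∷ᶜ []ᶜ)

suffix-0 : ∀ k → suffix 0 k ≡ 0
suffix-0 zero    = refl
suffix-0 (suc k) = cong tl (suffix-0 k)

suffix-suc : ∀ l k → suffix l (suc k) ≡ suffix (tl l) k
suffix-suc l zero    = refl
suffix-suc l (suc k) = cong tl (suffix-suc l k)

suffix-+ : ∀ l i j → suffix (suffix l i) j ≡ suffix l (i + j)
suffix-+ l i zero    = cong (suffix l) (sym (+-identityʳ i))
suffix-+ l i (suc j) = trans (cong tl (suffix-+ l i j)) (cong (suffix l) (sym (+-suc i j)))

suffix-codeList : ∀ ls k → suffix (codeList ls) k ≡ codeList (drop k ls)
suffix-codeList ls       zero    = refl
suffix-codeList []       (suc k) = trans (suffix-suc 0 k) (suffix-0 k)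
suffix-codeList (y ∷ ys) (suc k) = begin
  suffix (codeList (y ∷ ys)) (suc k)     ≡⟨ suffix-suc _ k ⟩
  suffix (tl (codeList (y ∷ ys))) k      ≡⟨ cong (λ l → suffix l k) (tl-codeList y ys) ⟩
  suffix (codeList ys) k                 ≡⟨ suffix-codeList ys k ⟩
  codeList (drop k ys)                   ∎
  where open ≡-Reasoning

suffix≤∸ : ∀ l k → suffix l k ≤ l ∸ k
suffix≤∸ l zero    = ≤-refl
suffix≤∸ l (suc k) = ≤-trans (tl≤pred (suffix l k))
  (subst (pred (suffix l k) ≤_) (pred[m∸n]≡m∸[1+n] l k) (pred-mono-≤ (suffix≤∸ l k)))

suffix≢0⇒< : ∀ l k → NZ (suffix l k) → k < l
suffix≢0⇒< l k h = m∸n≢0⇒n<m (λ e → h (n≤0⇒n≡0 (subst (suffix l k ≤_) e (suffix≤∸ l k))))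

suffix≤ : ∀ l k → suffix l k ≤ l
suffix≤ l k = ≤-trans (suffix≤∸ l k) (m∸n≤m l k)

length≤codeList : ∀ ls → length ls ≤ codeList ls
length≤codeList []       = z≤n
length≤codeList (y ∷ ys) = s≤s (≤-trans (length≤codeList ys) (m≤n+m _ _))

-- The first argument is fuel; it never runs out since tl l < l.
decodeFuel : ℕ → ℕ → List ℕ
decodeFuel zero    _       = []
decodeFuel (suc f) zero    = []
decodeFuel (suc f) (suc m) = unpair₁ m ∷ decodeFuel f (unpair₂ m)

decode : ℕ → List ℕ
decode m = decodeFuel m m

codeList-decodeFuel : ∀ f m → m ≤ f → codeList (decodeFuel f m) ≡ m
codeList-decodeFuel zero    zero    _ = refl
codeList-decodeFuel (suc f) zero    _ = refl
codeList-decodeFuel (suc f) (suc m) (s≤s m≤f) = cong suc (begin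
  pair (unpair₁ m) (codeList (decodeFuel f (unpair₂ m)))
    ≡⟨ cong (pair (unpair₁ m)) (codeList-decodeFuel f (unpair₂ m) (≤-trans (unpair₂≤ m) m≤f)) ⟩
  pair (unpair₁ m) (unpair₂ m)
    ≡⟨ pair-unpair m ⟩
  m ∎)
  where open ≡-Reasoning

codeList-decode : ∀ m → codeList (decode m) ≡ m
codeList-decode m = codeList-decodeFuel m m ≤-refl

All-decodeFuel : ∀ {Q : ℕ → Set} f m → (∀ j → NZ (suffix m j) → Q (hd (suffix m j))) → All Q (decodeFuel f m)
All-decodeFuel     zero    m       h = []
All-decodeFuel     (suc f) zero    h = []
All-decodeFuel {Q} (suc f) (suc m) h = h 0 (λ ()) ∷ All-decodeFuel f (unpair₂ m)
  (λ j nz → subst (Q ∘ hd) (suffix-suc (suc m) j) (h (suc j) (subst NZ (sym (suffix-suc (suc m) j)) nz)))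

codeList-hd∷decode-tl : ∀ w → NZ w → codeList (hd w ∷ decode (tl w)) ≡ w
codeList-hd∷decode-tl zero    h = ⊥-elim (h refl)
codeList-hd∷decode-tl (suc w) h = cong suc (trans (cong (pair (unpair₁ w)) (codeList-decode (unpair₂ w))) (pair-unpair w))

-- Clocked evaluation

-- run c t xs is suc y if c yields y at xs when every search of minF is cut off at t, and 0
-- otherwise. The state of minSearch is 0 while searching, 1 once stuck, and suc (suc y) once
-- the least zero y has been found.

allPos : ∀ {m} → Vec ℕ m → ℕ
allPos []       = 1
allPos (r ∷ rs) = guard r (allPos rs)

minStep : ℕ → ℕ → ℕ → ℕ
minStep s r j = ifz s (ifz r 1 (ifz (pred r) (suc (suc j)) 0)) s

mutual
  run : ∀ {k} → PR k → ℕ → Vec ℕ k → ℕ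
  run zeroF        t xs       = 1
  run succF        t xs       = suc (suc (lookup xs zero))
  run (projF i)    t xs       = suc (lookup xs i)
  run (compF f gs) t xs       = guard (allPos (run* gs t xs)) (run f t (map pred (run* gs t xs)))
  run (recF f g)   t (k ∷ xs) = recRun f g t k xs
  run (minF f)     t xs       = pred (minSearch f t xs t)

  recRun : ∀ {n} → PR n → PR (suc (suc n)) → ℕ → ℕ → Vec ℕ n → ℕ
  recRun f g t zero    xs = run f t xs
  recRun f g t (suc k) xs = guard (recRun f g t k xs) (run g t (k ∷ pred (recRun f g t k xs) ∷ xs))

  minSearch : ∀ {n} → PR (suc n) → ℕ → Vec ℕ n → ℕ → ℕ
  minSearch f t xs zero    = 0
  minSearch f t xs (suc j) = minStep (minSearch f t xs j) (run f t (j ∷ xs)) j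

  run* : ∀ {n m} → Vec (PR n) m → ℕ → Vec ℕ n → Vec ℕ m
  run* []       t xs = []
  run* (g ∷ gs) t xs = run g t xs ∷ run* gs t xs

runAt : ∀ {k} → PR k → Vec ℕ (suc k) → ℕ
runAt c (t ∷ xs) = run c t xs

runAt* : ∀ {n m} → Vec (PR n) m → Vec ℕ (suc n) → Vec ℕ m
runAt* gs (t ∷ xs) = run* gs t xs

recRunAt : ∀ {n} → PR n → PR (suc (suc n)) → Vec ℕ (suc (suc n)) → ℕ
recRunAt f g (k ∷ t ∷ xs) = recRun f g t k xs

minSearchAt : ∀ {n} → PR (suc n) → Vec ℕ (suc (suc n)) → ℕ
minSearchAt f (j ∷ t ∷ xs) = minSearch f t xs j

map-predᶜ : ∀ {m} → Computable* m m (map pred)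
map-predᶜ {zero}  = Computable*-resp []ᶜ (λ { [] → refl })
map-predᶜ {suc m} = Computable*-resp (compᶜ (proj₂ predᶠ) (projᶜ zero ∷ᶜ []ᶜ) ∷ᶜ compᶜ* map-predᶜ (dropᶜ 1))
                                     (λ { (x ∷ xs) → refl })

allPosᶜ : ∀ {m} → Computable m allPos
allPosᶜ {zero}  = Computable-resp (constᶜ 1) (λ { [] → refl })
allPosᶜ {suc m} = Computable-resp (compᶜ guardᶜ (projᶜ zero ∷ᶜ compᶜ allPosᶜ (dropᶜ 1) ∷ᶜ []ᶜ))
                                  (λ { (x ∷ xs) → refl })

minStepᶠ : CompFn 3
minStepᶠ = (λ xs → minStep (lookup xs zero) (lookup xs (# 1)) (lookup xs (# 2))) ,
  Computable-resp (compile (app₃ ifzᶠ (var zero)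
                    (app₃ ifzᶠ (var (# 1)) (lit 1)
                      (app₃ ifzᶠ (app₁ predᶠ (var (# 1))) (app₂ +ᶠ (lit 2) (var (# 2))) (lit 0)))
                    (var zero)))
                  (λ { (s ∷ r ∷ j ∷ []) → refl })

mutual
  runᶜ : ∀ {k} (c : PR k) → Computable (suc k) (runAt c)
  runᶜ zeroF     = Computable-resp (constᶜ 1) (λ { (t ∷ xs) → refl })
  runᶜ succF     = Computable-resp (compᶜ sucᶜ (compᶜ sucᶜ (projᶜ (# 1) ∷ᶜ []ᶜ) ∷ᶜ []ᶜ))
                                   (λ { (t ∷ x ∷ []) → refl })
  runᶜ (projF i) = Computable-resp (compᶜ sucᶜ (projᶜ (suc i) ∷ᶜ []ᶜ)) (λ { (t ∷ xs) → refl })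
  runᶜ (compF f gs) = Computable-resp
    (compᶜ guardᶜ (compᶜ allPosᶜ (run*ᶜ gs)
                ∷ᶜ compᶜ (runᶜ f) (projᶜ zero ∷ᶜ compᶜ* map-predᶜ (run*ᶜ gs))
                ∷ᶜ []ᶜ))
    (λ { (t ∷ xs) → refl })
  runᶜ (recF f g) = Computable-resp
    (compᶜ (recᶜ {h = recRunAt f g} (runᶜ f)
                 (compᶜ guardᶜ (projᶜ (# 1) ∷ᶜ compᶜ (runᶜ g) (projᶜ (# 2) ∷ᶜ projᶜ zero
                                 ∷ᶜ compᶜ (proj₂ predᶠ) (projᶜ (# 1) ∷ᶜ []ᶜ) ∷ᶜ dropᶜ 3) ∷ᶜ []ᶜ))
                 (λ { (t ∷ xs) → refl }) (λ { k (t ∷ xs) → refl }))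
           (projᶜ (# 1) ∷ᶜ projᶜ zero ∷ᶜ dropᶜ 2))
    (λ { (t ∷ k ∷ xs) → refl })
  runᶜ (minF f) = Computable-resp
    (compᶜ (compᶜ (proj₂ predᶠ) (recᶜ {h = minSearchAt f} zeroᶜ
                                      (compᶜ (proj₂ minStepᶠ) (projᶜ (# 1) ∷ᶜ compᶜ (runᶜ f) (projᶜ (# 2) ∷ᶜ projᶜ zero
                                                                  ∷ᶜ dropᶜ 3) ∷ᶜ projᶜ zero ∷ᶜ []ᶜ))
                                      (λ { (t ∷ xs) → refl }) (λ { k (t ∷ xs) → refl }) ∷ᶜ []ᶜ))
           (projᶜ zero ∷ᶜ idᶜ))
    (λ { (t ∷ xs) → refl })

  run*ᶜ : ∀ {n m} (gs : Vec (PR n) m) → Computable* (suc n) m (runAt* gs)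
  run*ᶜ []       = Computable*-resp []ᶜ (λ { (t ∷ xs) → refl })
  run*ᶜ (g ∷ gs) = Computable*-resp (runᶜ g ∷ᶜ run*ᶜ gs) (λ { (t ∷ xs) → refl })

RunsNonzero : ∀ {n} → PR (suc n) → ℕ → Vec ℕ n → ℕ → Set
RunsNonzero f t xs z = Σ ℕ λ w → run f t (z ∷ xs) ≡ suc (suc w)

minSearch≡0⇒nonzero : ∀ {n} (f : PR (suc n)) t xs j → minSearch f t xs j ≡ 0 →
                      ∀ z → z < j → RunsNonzero f t xs z
minSearch≡0⇒nonzero f t xs (suc j) e z z<1+j with minSearch f t xs j in e₁ | run f t (j ∷ xs) in e₂
minSearch≡0⇒nonzero f t xs (suc j) () z z<1+j | zero  | zero
minSearch≡0⇒nonzero f t xs (suc j) () z z<1+j | zero  | suc zero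
minSearch≡0⇒nonzero f t xs (suc j) () z z<1+j | suc s | r
minSearch≡0⇒nonzero f t xs (suc j) e  z z<1+j | zero  | suc (suc w) with m≤n⇒m<n∨m≡n (≤-pred z<1+j)
... | inj₁ z<j  = minSearch≡0⇒nonzero f t xs j e₁ z z<j
... | inj₂ refl = w , e₂

minSearch-found : ∀ {n} (f : PR (suc n)) t xs j y → minSearch f t xs j ≡ suc (suc y) →
                  run f t (y ∷ xs) ≡ 1 × (∀ z → z < y → RunsNonzero f t xs z)
minSearch-found f t xs (suc j) y e with minSearch f t xs j in e₁ | run f t (j ∷ xs) in e₂
minSearch-found f t xs (suc j) y  ()   | zero  | zero
minSearch-found f t xs (suc j) .j refl | zero  | suc zero    = e₂ , minSearch≡0⇒nonzero f t xs j e₁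
minSearch-found f t xs (suc j) y  ()   | zero  | suc (suc w)
minSearch-found f t xs (suc j) y  e    | suc s | r           = minSearch-found f t xs j y (trans e₁ e)

minSearch-below : ∀ {n} (f : PR (suc n)) t xs y → (∀ z → z < y → RunsNonzero f t xs z) →
                  ∀ j → j ≤ y → minSearch f t xs j ≡ 0
minSearch-below f t xs y h zero    j≤y = refl
minSearch-below f t xs y h (suc j) j<y with h j j<y
... | (w , e) rewrite minSearch-below f t xs y h j (≤-trans (n≤1+n j) j<y) | e = refl

minSearch-above : ∀ {n} (f : PR (suc n)) t xs y → (∀ z → z < y → RunsNonzero f t xs z) →
                  run f t (y ∷ xs) ≡ 1 → ∀ d → minSearch f t xs (suc y + d) ≡ suc (suc y)
minSearch-above f t xs y h e zero
  rewrite +-identityʳ y | minSearch-below f t xs y h y ≤-refl | e = refl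
minSearch-above f t xs y h e (suc d)
  rewrite +-suc y d | minSearch-above f t xs y h e d = refl

mutual
  run-sound : ∀ {k} (c : PR k) t xs y → run c t xs ≡ suc y → Eval c xs y
  run-sound zeroF     t xs       .0              refl = evZero
  run-sound succF     t (x ∷ []) .(suc x)        refl = evSucc
  run-sound (projF i) t xs       .(lookup xs i)  refl = evProj
  run-sound (compF f gs) t xs y e with allPos (run* gs t xs) in all-halt
  ... | suc _ = evComp (run*-sound gs t xs (λ e′ → 1+n≢0 (trans (sym all-halt) e′))) (run-sound f t _ y e)
  run-sound (recF f g) t (k ∷ xs) y e = recRun-sound f g t k xs y e
  run-sound (minF f) t xs y e with minSearch f t xs t in found
  ... | suc (suc _) with e
  ... | refl = evMin (run-sound f t (y ∷ xs) 0 (proj₁ (minSearch-found f t xs t y found)))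
                     (λ z z<y → let (w , ew) = proj₂ (minSearch-found f t xs t y found) z z<y
                                in w , run-sound f t (z ∷ xs) (suc w) ew)

  recRun-sound : ∀ {n} (f : PR n) g t k xs y → recRun f g t k xs ≡ suc y → Eval (recF f g) (k ∷ xs) y
  recRun-sound f g t zero    xs y e = evRec0 (run-sound f t xs y e)
  recRun-sound f g t (suc k) xs y e with recRun f g t k xs in previous
  ... | suc z = evRecS (recRun-sound f g t k xs z previous) (run-sound g t _ y e)

  run*-sound : ∀ {n m} (gs : Vec (PR n) m) t xs → NZ (allPos (run* gs t xs)) →
               EvalAll gs xs (map pred (run* gs t xs))
  run*-sound []       t xs h = evNil
  run*-sound (g ∷ gs) t xs h with run g t xs in eg
  ... | zero  = ⊥-elim (h refl)
  ... | suc y = evCons (run-sound g t xs y eg) (run*-sound gs t xs h)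

Eventually : (ℕ → Set) → Set
Eventually P = Σ ℕ λ T → ∀ t → T ≤ t → P t

eventually-× : ∀ {P Q} → Eventually P → Eventually Q → Eventually (λ t → P t × Q t)
eventually-× (T₁ , p) (T₂ , q) =
  T₁ + T₂ , λ t le → p t (≤-trans (m≤m+n T₁ T₂) le) , q t (≤-trans (m≤n+m T₂ T₁) le)

eventually-∀< : ∀ (P : ℕ → ℕ → Set) y → (∀ z → z < y → Eventually (P z)) →
                Eventually (λ t → ∀ z → z < y → P z t)
eventually-∀< P zero    h = 0 , λ t _ z ()
eventually-∀< P (suc y) h
  with eventually-× (eventually-∀< P y (λ z z<y → h z (≤-trans z<y (n≤1+n y)))) (h y ≤-refl)
... | (T , p) = T , λ t le z z<1+y → below-or-at (p t le) (m≤n⇒m<n∨m≡n (≤-pred z<1+y))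
  where
  below-or-at : ∀ {z t} → (∀ z → z < y → P z t) × P y t → z < y ⊎ z ≡ y → P z t
  below-or-at (below , _)  (inj₁ z<y)  = below _ z<y
  below-or-at (_ , at)     (inj₂ refl) = at

allPos-map-suc : ∀ {m} (ys : Vec ℕ m) → allPos (map suc ys) ≡ 1
allPos-map-suc []       = refl
allPos-map-suc (y ∷ ys) = allPos-map-suc ys

map-pred-map-suc : ∀ {m} (ys : Vec ℕ m) → map pred (map suc ys) ≡ ys
map-pred-map-suc []       = refl
map-pred-map-suc (y ∷ ys) = cong (y ∷_) (map-pred-map-suc ys)

mutual
  run-complete : ∀ {k} {c : PR k} {xs y} → Eval c xs y → Eventually (λ t → run c t xs ≡ suc y)
  run-complete evZero = 0 , λ t _ → refl
  run-complete evSucc = 0 , λ t _ → refl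
  run-complete evProj = 0 , λ t _ → refl
  run-complete {c = compF f gs} (evComp {ys = ys} ea ef) with eventually-× (run*-complete ea) (run-complete ef)
  ... | (T , p) = T , λ t le → let (e₁ , e₂) = p t le in begin
    guard (allPos (run* gs t _)) (run f t (map pred (run* gs t _)))
      ≡⟨ cong (λ r → guard (allPos r) (run f t (map pred r))) e₁ ⟩
    guard (allPos (map suc ys)) (run f t (map pred (map suc ys)))
      ≡⟨ cong₂ guard (allPos-map-suc ys) (cong (run f t) (map-pred-map-suc ys)) ⟩
    run f t ys
      ≡⟨ e₂ ⟩
    _ ∎
    where open ≡-Reasoning
  run-complete (evRec0 e) = run-complete e
  run-complete {c = recF f g} (evRecS {k = k} e₁ e₂) with eventually-× (run-complete e₁) (run-complete e₂)
  ... | (T , p) = T , λ t le → let (q₁ , q₂) = p t le in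
        trans (cong (λ r → guard r (run g t (k ∷ pred r ∷ _))) q₁) q₂
  run-complete {c = minF f} {xs} {y} (evMin e₀ h)
    with eventually-× (run-complete e₀) (eventually-∀< _ y (λ z z<y → run-complete-nonzero (h z z<y)))
  ... | (T , p) = T + suc y , λ t le →
        let (q₀ , q<) = p t (≤-trans (m≤m+n T (suc y)) le)
            t≡1+y+d  = sym (m+[n∸m]≡n (≤-trans (m≤n+m (suc y) T) le))
        in cong pred (trans (cong (minSearch f t xs) t≡1+y+d) (minSearch-above f t xs y q< q₀ (t ∸ suc y)))

  run-complete-nonzero : ∀ {n} {f : PR (suc n)} {z xs} → Σ ℕ (λ w → Eval f (z ∷ xs) (suc w)) →
                         Eventually (λ t → RunsNonzero f t xs z)
  run-complete-nonzero (w , e) with run-complete e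
  ... | (T , p) = T , λ t le → w , p t le

  run*-complete : ∀ {n m} {gs : Vec (PR n) m} {xs ys} → EvalAll gs xs ys →
                  Eventually (λ t → run* gs t xs ≡ map suc ys)
  run*-complete evNil = 0 , λ t _ → refl
  run*-complete (evCons e es) with eventually-× (run-complete e) (run*-complete es)
  ... | (T , p) = T , λ t le → let (q₁ , q₂) = p t le in cong₂ _∷_ q₁ q₂

%2ᶠ : CompFn 1
%2ᶠ = (λ xs → lookup xs zero % 2) ,
  recᶜ zeroᶜ (compile (app₁ isZeroᶠ (var (# 1)))) (λ _ → refl) (λ { n [] → %2-suc n })
  where
  %2-suc : ∀ n → suc n % 2 ≡ isZero (n % 2)
  %2-suc zero          = refl
  %2-suc (suc zero)    = refl
  %2-suc (suc (suc n)) = %2-suc n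

/2ᶠ : CompFn 1
/2ᶠ = (λ xs → lookup xs zero / 2) ,
  recᶜ zeroᶜ (compile (app₂ +ᶠ (var (# 1)) (app₁ %2ᶠ (var zero)))) (λ _ → refl) (λ { n [] → /2-suc n })
  where
  /2-+2 : ∀ n → suc (suc n) / 2 ≡ suc (n / 2)
  /2-+2 n = m/n≡1+[m∸n]/n {suc (suc n)} {2} (s≤s (s≤s z≤n))
  /2-suc : ∀ n → suc n / 2 ≡ n / 2 + n % 2
  /2-suc zero          = refl
  /2-suc (suc zero)    = refl
  /2-suc (suc (suc n)) = begin
    suc (suc (suc n)) / 2    ≡⟨ /2-+2 (suc n) ⟩
    suc (suc n / 2)          ≡⟨ cong suc (/2-suc n) ⟩
    suc (n / 2 + n % 2)      ≡⟨ cong (_+ n % 2) (sym (/2-+2 n)) ⟩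
    suc (suc n) / 2 + n % 2  ∎
    where open ≡-Reasoning

halvings : ℕ → ℕ → ℕ
halvings zero    u = u
halvings (suc i) u = halvings i u / 2

halvingsᶠ : CompFn 2
halvingsᶠ = (λ xs → halvings (lookup xs zero) (lookup xs (# 1))) ,
  recᶜ (projᶜ zero) (compile (app₁ /2ᶠ (var (# 1)))) (λ _ → refl) (λ _ _ → refl)

bit-halvings : ∀ i u → bit i u ≡ halvings i u % 2
bit-halvings zero    u = refl
bit-halvings (suc i) u = trans (bit-halvings i (u / 2)) (cong (_% 2) (halvings-/2 i))
  where
  halvings-/2 : ∀ i → halvings i (u / 2) ≡ halvings i u / 2
  halvings-/2 zero    = refl
  halvings-/2 (suc i) = cong (_/ 2) (halvings-/2 i)

bitᶠ : CompFn 2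
bitᶠ = (λ xs → bit (lookup xs zero) (lookup xs (# 1))) ,
  Computable-resp (compile (app₁ %2ᶠ (app₂ halvingsᶠ (var zero) (var (# 1)))))
                  (λ { (i ∷ u ∷ []) → sym (bit-halvings i u) })

bit≢0⇒≡1 : ∀ i u → NZ (bit i u) → bit i u ≡ 1
bit≢0⇒≡1 zero    u h = digit (u % 2) (m%n<n u 2) h
  where
  digit : ∀ d → d < 2 → NZ d → d ≡ 1
  digit zero          _               h = ⊥-elim (h refl)
  digit (suc zero)    _               _ = refl
  digit (suc (suc d)) (s≤s (s≤s ()))  _
bit≢0⇒≡1 (suc i) u h = bit≢0⇒≡1 i (u / 2) h

Bits : ℕ → Pred ℕ 0ℓ
Bits u i = bit i u ≡ 1

bit-0 : ∀ i → bit i 0 ≡ 0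
bit-0 zero    = refl
bit-0 (suc i) = bit-0 i

digit : ∀ {A : Set} → Dec A → ℕ
digit (yes _) = 1
digit (no _)  = 0

digit≡1⇒ : ∀ {A : Set} (a? : Dec A) → digit a? ≡ 1 → A
digit≡1⇒ (yes a) _ = a

digit-yes : ∀ {A : Set} (a? : Dec A) → A → digit a? ≡ 1
digit-yes (yes _) a = refl
digit-yes (no ¬a) a = ⊥-elim (¬a a)

bit-zero-digit+*2 : ∀ {A : Set} (a? : Dec A) m → bit 0 (digit a? + m * 2) ≡ digit a?
bit-zero-digit+*2 (no _)  m = m*n%n≡0 m 2
bit-zero-digit+*2 (yes _) m = [m+kn]%n≡m%n 1 m 2

bit-suc-digit+*2 : ∀ {A : Set} (a? : Dec A) m i → bit (suc i) (digit a? + m * 2) ≡ bit i m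
bit-suc-digit+*2 (no _)  m i = cong (bit i) (m*n/n≡m m 2)
bit-suc-digit+*2 (yes _) m i = cong (bit i) (trans (+-distrib-/ 1 (m * 2) 1+m*2%2<2) (m*n/n≡m m 2))
  where
  1+m*2%2<2 : 1 + (m * 2) % 2 < 2
  1+m*2%2<2 = subst (λ r → 1 + r < 2) (sym (m*n%n≡0 m 2)) ≤-refl

fromDecs : {P : Pred ℕ 0ℓ} → (∀ i → Dec (P i)) → ℕ → ℕ
fromDecs P? zero    = 0
fromDecs P? (suc l) = digit (P? 0) + fromDecs (P? ∘ suc) l * 2

bit-fromDecs-< : ∀ {P : Pred ℕ 0ℓ} (P? : ∀ i → Dec (P i)) l i → i < l → bit i (fromDecs P? l) ≡ digit (P? i)
bit-fromDecs-< P? (suc l) zero    _         = bit-zero-digit+*2 (P? 0) (fromDecs (P? ∘ suc) l)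
bit-fromDecs-< P? (suc l) (suc i) (s≤s i<l) =
  trans (bit-suc-digit+*2 (P? 0) (fromDecs (P? ∘ suc) l) i) (bit-fromDecs-< (P? ∘ suc) l i i<l)

bit-fromDecs-≥ : ∀ {P : Pred ℕ 0ℓ} (P? : ∀ i → Dec (P i)) l i → l ≤ i → bit i (fromDecs P? l) ≡ 0
bit-fromDecs-≥ P? zero    i       _         = bit-0 i
bit-fromDecs-≥ P? (suc l) (suc i) (s≤s l≤i) =
  trans (bit-suc-digit+*2 (P? 0) (fromDecs (P? ∘ suc) l) i) (bit-fromDecs-≥ (P? ∘ suc) l i l≤i)

upperBound : List ℕ → ℕ
upperBound []       = 0
upperBound (y ∷ ys) = suc y + upperBound ys

∈⇒<upperBound : ∀ {p} ys → p ∈ ys → p < upperBound ys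
∈⇒<upperBound (y ∷ ys) (here refl) = s≤s (m≤m+n y (upperBound ys))
∈⇒<upperBound (y ∷ ys) (there p∈ys) = ≤-trans (∈⇒<upperBound ys p∈ys) (m≤n+m (upperBound ys) (suc y))

finite-subset-code : ExcludedMiddle 0ℓ → (X : Pred ℕ 0ℓ) (ps : List ℕ) →
  Σ ℕ λ u → (∀ i → Bits u i → X i) × (∀ p → p ∈ ps → X p → Bits u p)
finite-subset-code em X ps = fromDecs P? l , ⊆X , ⊇X∩ps
  where
  P? : ∀ i → Dec (i ∈ ps × X i)
  P? i = em
  l = upperBound ps
  ⊆X : ∀ i → bit i (fromDecs P? l) ≡ 1 → X i
  ⊆X i h with i <? l
  ... | yes i<l = proj₂ (digit≡1⇒ (P? i) (trans (sym (bit-fromDecs-< P? l i i<l)) h))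
  ... | no  i≮l = ⊥-elim (0≢1+n (trans (sym (bit-fromDecs-≥ P? l i (≮⇒≥ i≮l))) h))
  ⊇X∩ps : ∀ p → p ∈ ps → X p → bit p (fromDecs P? l) ≡ 1
  ⊇X∩ps p p∈ps Xp = trans (bit-fromDecs-< P? l p (∈⇒<upperBound ps p∈ps)) (digit-yes (P? p) (p∈ps , Xp))

-- Derivations

data Derivable (S : SeqSet) (Z : Pred ℕ 0ℓ) : Pred ℕ 0ℓ where
  hyp  : ∀ {z} → Z z → Derivable S Z z
  rule : ∀ {z ns} → S z ns → All (Derivable S Z) ns → Derivable S Z z

module _ {S : SeqSet} where

  Derivable-InV : ∀ {Z} → InV S (Derivable S Z)
  Derivable-InV _ _ = rule

  mutual
    Derivable-mono : ∀ {Z Z′ : Pred ℕ 0ℓ} → Z ⊆ Z′ → Derivable S Z ⊆ Derivable S Z′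
    Derivable-mono Z⊆Z′ (hyp z)     = hyp (Z⊆Z′ z)
    Derivable-mono Z⊆Z′ (rule s ds) = rule s (Derivable*-mono Z⊆Z′ ds)

    Derivable*-mono : ∀ {Z Z′ : Pred ℕ 0ℓ} → Z ⊆ Z′ → All (Derivable S Z) ⊆ All (Derivable S Z′)
    Derivable*-mono Z⊆Z′ []       = []
    Derivable*-mono Z⊆Z′ (d ∷ ds) = Derivable-mono Z⊆Z′ d ∷ Derivable*-mono Z⊆Z′ ds

  mutual
    Derivable-least : ∀ {Z X : Pred ℕ 0ℓ} → InV S X → Z ⊆ X → Derivable S Z ⊆ X
    Derivable-least inV Z⊆X (hyp z)              = Z⊆X z
    Derivable-least inV Z⊆X (rule {z} {ns} s ds) = inV z ns s (Derivable*-least inV Z⊆X ds)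

    Derivable*-least : ∀ {Z X : Pred ℕ 0ℓ} → InV S X → Z ⊆ X → All (Derivable S Z) ⊆ All X
    Derivable*-least inV Z⊆X []       = []
    Derivable*-least inV Z⊆X (d ∷ ds) = Derivable-least inV Z⊆X d ∷ Derivable*-least inV Z⊆X ds

maximal⇒derivable : ∀ {S X x} → Maximal S X → ∁ X x → ∀ a → Derivable S (X ∪ ｛ x ｝) a
maximal⇒derivable {S} {X} {x} (_ , maximal) x∉X a
  with maximal (Derivable S (X ∪ ｛ x ｝)) Derivable-InV (λ Xp → hyp (inj₁ Xp))
... | inj₁ closure⊆X = ⊥-elim (x∉X (closure⊆X (hyp (inj₂ refl))))
... | inj₂ closure=I = closure=I a

derivable⇒∁ : ∀ {S X x a} → InV S X → ∁ X a → Derivable S (X ∪ ｛ x ｝) a → ∁ X x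
derivable⇒∁ inV a∉X d Xx = a∉X (Derivable-least inV (λ { (inj₁ Xp) → Xp ; (inj₂ refl) → Xx }) d)

-- Linear derivations: lists of rules n₀ ∷ ns, each premise of which is a hypothesis or the
-- conclusion of a later rule.

conclusion : List ℕ → ℕ
conclusion []      = 0
conclusion (z ∷ _) = z

premises : List ℕ → List ℕ
premises []       = []
premises (_ ∷ ns) = ns

conclusions : List (List ℕ) → List ℕ
conclusions = L.map conclusion

hd-codeList-conclusion : ∀ r → hd (codeList r) ≡ conclusion r
hd-codeList-conclusion []       = refl
hd-codeList-conclusion (z ∷ ns) = hd-codeList z ns

allPremises : List (List ℕ) → List ℕ
allPremises []       = []
allPremises (r ∷ rs) = premises r ++ allPremises rs

Step : SeqSet → Pred ℕ 0ℓ → List (List ℕ) → List ℕ → Set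
Step S Z rs []       = ⊥
Step S Z rs (z ∷ ns) = S z ns × All (Z ∪ (_∈ conclusions rs)) ns

Valid : SeqSet → Pred ℕ 0ℓ → List (List ℕ) → Set
Valid S Z []       = ⊤
Valid S Z (r ∷ rs) = Step S Z rs r × Valid S Z rs

∈-conclusions-++ˡ : ∀ {p} rs ss → p ∈ conclusions rs → p ∈ conclusions (rs ++ ss)
∈-conclusions-++ˡ rs ss p∈ = subst (_ ∈_) (sym (map-++ conclusion rs ss)) (∈-++⁺ˡ p∈)

∈-conclusions-++ʳ : ∀ {p} rs ss → p ∈ conclusions ss → p ∈ conclusions (rs ++ ss)
∈-conclusions-++ʳ rs ss p∈ = subst (_ ∈_) (sym (map-++ conclusion rs ss)) (∈-++⁺ʳ (conclusions rs) p∈)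

module _ {S : SeqSet} {Z : Pred ℕ 0ℓ} where

  Valid-++ : ∀ rs ss → Valid S Z rs → Valid S Z ss → Valid S Z (rs ++ ss)
  Valid-++ []              ss _                  valid-ss = valid-ss
  Valid-++ ((z ∷ ns) ∷ rs) ss ((s , prem) , valid) valid-ss =
    (s , All.map (Sum.map₂ (∈-conclusions-++ˡ rs ss)) prem) , Valid-++ rs ss valid valid-ss

  mutual
    linearize : ∀ {z} → Derivable S Z z → Σ (List (List ℕ)) λ rs → Valid S Z rs × (Z z ⊎ z ∈ conclusions rs)
    linearize (hyp h) = [] , tt , inj₁ h
    linearize (rule {z} {ns} s ds) =
      let (rs , valid , prem) = linearize* ds in (z ∷ ns) ∷ rs , ((s , prem) , valid) , inj₂ (here refl)

    linearize* : ∀ {ns} → All (Derivable S Z) ns →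
                 Σ (List (List ℕ)) λ rs → Valid S Z rs × All (Z ∪ (_∈ conclusions rs)) ns
    linearize* []       = [] , tt , []
    linearize* (d ∷ ds) =
      let (rs₁ , valid₁ , d-concl) = linearize d
          (rs₂ , valid₂ , ds-concl) = linearize* ds
      in rs₁ ++ rs₂ , Valid-++ rs₁ rs₂ valid₁ valid₂ ,
         Sum.map₂ (∈-conclusions-++ˡ rs₁ rs₂) d-concl
           ∷ All.map (Sum.map₂ (∈-conclusions-++ʳ rs₁ rs₂)) ds-concl

  Valid-drop : ∀ j rs {r rs′} → Valid S Z rs → drop j rs ≡ r ∷ rs′ → Step S Z rs′ r
  Valid-drop zero    (r ∷ rs) (step , _) refl = step
  Valid-drop (suc j) (r ∷ rs) (_ , valid) eq  = Valid-drop j rs valid eq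

  Valid-mono : ∀ {Z′ : Pred ℕ 0ℓ} rs → (∀ {p} → p ∈ allPremises rs → Z p → Z′ p) →
               Valid S Z rs → Valid S Z′ rs
  Valid-mono []              h _                    = tt
  Valid-mono ((z ∷ ns) ∷ rs) h ((s , prem) , valid) =
    (s , All.tabulate (λ p∈ns → Sum.map₁ (h (∈-++⁺ˡ p∈ns)) (All.lookup prem p∈ns))) ,
    Valid-mono rs (λ p∈ → h (∈-++⁺ʳ ns p∈)) valid

∈-drop⇒∈ : ∀ {A : Set} {q : A} j (ls : List A) → q ∈ drop j ls → q ∈ ls
∈-drop⇒∈ zero    ls       q∈ = q∈
∈-drop⇒∈ (suc j) []       q∈ = q∈
∈-drop⇒∈ (suc j) (y ∷ ys) q∈ = there (∈-drop⇒∈ j ys q∈)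

drop≡∷⇒∈ : ∀ {A : Set} j (ls : List A) {r rs} → drop j ls ≡ r ∷ rs → r ∈ ls
drop≡∷⇒∈ j ls eq = ∈-drop⇒∈ j ls (subst (_ ∈_) (sym eq) (here refl))

∈-conclusions⇒drop : ∀ {p} rs → p ∈ conclusions rs →
  Σ ℕ λ i → Σ (List ℕ) λ r → Σ (List (List ℕ)) λ rs′ →
  drop i rs ≡ r ∷ rs′ × conclusion r ≡ p × i < length rs
∈-conclusions⇒drop (r ∷ rs) (here eq) = 0 , r , rs , refl , sym eq , s≤s z≤n
∈-conclusions⇒drop (r ∷ rs) (there p∈) =
  let (i , r′ , rs′ , dropped , concl , i<) = ∈-conclusions⇒drop rs p∈
  in suc i , r′ , rs′ , dropped , concl , s≤s i<

-- The reduction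

⊆code-guard⁻ : ∀ X c u → guard c (suc u) ⊆code X → NZ c × (∀ i → Bits u i → X i)
⊆code-guard⁻ X (suc c) u h = (λ ()) , h

⊆code-guard⁺ : ∀ X c u → NZ c → (∀ i → Bits u i → X i) → guard c (suc u) ⊆code X
⊆code-guard⁺ X zero    u c≢0 h = ⊥-elim (c≢0 refl)
⊆code-guard⁺ X (suc c) u c≢0 h = h

≡1⇒NZ : ∀ {n} → n ≡ 1 → NZ n
≡1⇒NZ refl = λ ()

ifz-1⁻ : ∀ s b → NZ s → NZ (ifz s 1 b) → NZ b
ifz-1⁻ zero    b h _ = ⊥-elim (h refl)
ifz-1⁻ (suc s) b _ h = h

module Reduction (S : SeqSet) (e : PR 1)
  (e-enumerates : ∀ n₀ ns → S n₀ ns ⇔ ∃ (λ y → Eval e (codeList (n₀ ∷ ns) ∷ []) y)) (a : ℕ) where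

  runᶠ : CompFn 2
  runᶠ = (λ xs → run e (lookup xs zero) (lookup xs (# 1) ∷ [])) ,
    Computable-resp (runᶜ e) (λ { (t ∷ m ∷ []) → refl })

  -- l codes a list of codes of rules n₀ ∷ ns. premOK x u p l: p is in Bits u, is x, or is the
  -- conclusion of a rule of l. stepOK x u t l: the first rule of l is accepted by e within
  -- clock t and its premises are premOK for the rest of l.
  premOK : ℕ → ℕ → ℕ → ℕ → ℕ
  premOK x u p l = orN (bit p u) (orN (eqN x p) (anyBelow l (λ i → guard (suffix l i) (eqN (hd (hd (suffix l i))) p))))

  premOKᶠ : CompFn 4
  premOKᶠ = (λ xs → premOK (lookup xs zero) (lookup xs (# 1)) (lookup xs (# 2)) (lookup xs (# 3))) ,
    compile (app₂ orᶠ (app₂ bitᶠ (var (# 2)) (var (# 1)))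
              (app₂ orᶠ (app₂ eqᶠ (var zero) (var (# 2)))
                (any< (var (# 3)) (app₂ guardᶠ (app₂ suffixᶠ (var (# 4)) (var zero))
                  (app₂ eqᶠ (app₁ hdᶠ (app₁ hdᶠ (app₂ suffixᶠ (var (# 4)) (var zero)))) (var (# 3)))))))

  premisesOK : ℕ → ℕ → ℕ → ℕ → ℕ
  premisesOK x u w l = allBelow w (λ j → ifz (suffix (tl w) j) 1 (premOK x u (hd (suffix (tl w) j)) l))

  stepOK : ℕ → ℕ → ℕ → ℕ → ℕ
  stepOK x u t l = guard (hd l) (guard (run e t (hd l ∷ [])) (premisesOK x u (hd l) (tl l)))

  stepOKᶠ : CompFn 4
  stepOKᶠ = (λ xs → stepOK (lookup xs zero) (lookup xs (# 1)) (lookup xs (# 2)) (lookup xs (# 3))) ,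
    compile (app₂ guardᶠ w (app₂ guardᶠ (app₂ runᶠ (var (# 2)) w) (all< w
              (app₃ ifzᶠ (app₂ suffixᶠ (app₁ tlᶠ w′) (var zero)) (lit 1)
                (app₄ premOKᶠ (var (# 1)) (var (# 2)) (app₁ hdᶠ (app₂ suffixᶠ (app₁ tlᶠ w′) (var zero)))
                              (app₁ tlᶠ (var (# 4))))))))
    where
    w : Expr 4
    w = app₁ hdᶠ (var (# 3))
    w′ : Expr 5
    w′ = app₁ hdᶠ (var (# 4))

  check : ℕ → ℕ → ℕ → ℕ → ℕ
  check x u L t = guard (premOK x u a L) (allBelow L (λ k → ifz (suffix L k) 1 (stepOK x u t (suffix L k))))

  checkᶠ : CompFn 4
  checkᶠ = (λ xs → check (lookup xs zero) (lookup xs (# 1)) (lookup xs (# 2)) (lookup xs (# 3))) ,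
    compile (app₂ guardᶠ (app₄ premOKᶠ (var zero) (var (# 1)) (lit a) (var (# 2)))
              (all< (var (# 2)) (app₃ ifzᶠ (app₂ suffixᶠ (var (# 3)) (var zero)) (lit 1)
                (app₄ stepOKᶠ (var (# 1)) (var (# 2)) (var (# 4)) (app₂ suffixᶠ (var (# 3)) (var zero))))))

  -- The witness n = pair u (pair L t): the finite set coded by u, the rules L, and the clock t.
  reduction : ℕ → ℕ → ℕ
  reduction x n = guard (check x (unpair₁ n) (unpair₁ (unpair₂ n)) (unpair₂ (unpair₂ n))) (suc (unpair₁ n))

  reduction-pair : ∀ x u L t → reduction x (pair u (pair L t)) ≡ guard (check x u L t) (suc u)
  reduction-pair x u L t
    rewrite unpair₁-pair u (pair L t) | unpair₂-pair u (pair L t) | unpair₁-pair L t | unpair₂-pair L t = refl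

  reduction-computable : Computable₂ reduction
  reduction-computable = code , λ x n → eval (x ∷ n ∷ [])
    where
    code,eval = compile (app₂ guardᶠ (app₄ checkᶠ (var zero) (app₁ unpair₁ᶠ (var (# 1)))
                                                 (app₁ unpair₁ᶠ (app₁ unpair₂ᶠ (var (# 1))))
                                                 (app₁ unpair₂ᶠ (app₁ unpair₂ᶠ (var (# 1)))))
                                     (app₁ sucᶠ (app₁ unpair₁ᶠ (var (# 1)))))
    code = proj₁ code,eval
    eval = proj₂ code,eval

  stepOK⁻ : ∀ x u t l → NZ (stepOK x u t l) →
            NZ (hd l) × NZ (run e t (hd l ∷ [])) × NZ (premisesOK x u (hd l) (tl l))
  stepOK⁻ x u t l h = guard⁻ˡ (hd l) rest h , guard⁻ˡ runs prems rest≢0 , guard⁻ʳ runs prems rest≢0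
    where
    runs = run e t (hd l ∷ [])
    prems = premisesOK x u (hd l) (tl l)
    rest = guard runs prems
    rest≢0 = guard⁻ʳ (hd l) rest h

  accepted⇒rule : ∀ t w → NZ w → NZ (run e t (w ∷ [])) → S (hd w) (decode (tl w))
  accepted⇒rule t w w≢0 accepted with run e t (w ∷ []) in halts
  ... | zero  = ⊥-elim (accepted refl)
  ... | suc y = Equivalence.from (e-enumerates (hd w) (decode (tl w)))
                  (y , subst (λ c → Eval e (c ∷ []) y) (sym (codeList-hd∷decode-tl w w≢0))
                             (run-sound e t (w ∷ []) y halts))

  module _ (x u t : ℕ) where

    StepsOK : ℕ → Set
    StepsOK l = ∀ j → NZ (suffix l j) → NZ (stepOK x u t (suffix l j))

    StepsOK-suffix : ∀ l i → StepsOK l → StepsOK (suffix l i)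
    StepsOK-suffix l i h j nz = subst (λ l′ → NZ (stepOK x u t l′)) (sym (suffix-+ l i j))
                                      (h (i + j) (subst NZ (suffix-+ l i j) nz))

    -- F bounds the code l; it decreases along the mutual recursion since tl l < l and suffix l i ≤ l.
    mutual
      premOK-sound : ∀ F l → l < F → StepsOK l → ∀ p → NZ (premOK x u p l) → Derivable S (Bits u ∪ ｛ x ｝) p
      premOK-sound (suc F) l (s≤s l≤F) steps p ok with orN⁻ _ _ ok
      ... | inj₁ in-u = hyp (inj₁ (bit≢0⇒≡1 p u in-u))
      ... | inj₂ ok′ with orN⁻ _ _ ok′
      ... | inj₁ is-x = hyp (inj₂ (eqN⇒≡ x p is-x))
      ... | inj₂ concluded with anyBelow⁻ l _ concluded
      ... | (i , _ , rule-i) = subst (Derivable S _) (eqN⇒≡ _ _ (guard⁻ʳ _ _ rule-i))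
              (stepOK-sound F (suffix l i) (≤-trans (suffix≤ l i) l≤F) (StepsOK-suffix l i steps) (guard⁻ˡ _ _ rule-i))

      stepOK-sound : ∀ F l → l ≤ F → StepsOK l → NZ l → Derivable S (Bits u ∪ ｛ x ｝) (hd (hd l))
      stepOK-sound F l l≤F steps l≢0 with stepOK⁻ x u t l (steps 0 l≢0)
      ... | w≢0 , accepted , prems =
        rule (accepted⇒rule t (hd l) w≢0 accepted) (All-decodeFuel (tl (hd l)) (tl (hd l)) premise)
        where
        premise : ∀ j → NZ (suffix (tl (hd l)) j) → Derivable S (Bits u ∪ ｛ x ｝) (hd (suffix (tl (hd l)) j))
        premise j nz = premOK-sound F (tl l) (<-≤-trans (tl< l l≢0) l≤F) (StepsOK-suffix l 1 steps) _
          (ifz-1⁻ _ _ nz (allBelow⁻ (hd l) _ prems j (<-trans (suffix≢0⇒< (tl (hd l)) j nz) (tl< (hd l) w≢0))))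

    check-sound : ∀ L → NZ (check x u L t) → Derivable S (Bits u ∪ ｛ x ｝) a
    check-sound L h = premOK-sound (suc L) L ≤-refl steps a (guard⁻ˡ _ _ h)
      where
      steps : StepsOK L
      steps j nz = ifz-1⁻ _ _ nz (allBelow⁻ L _ (guard⁻ʳ _ _ h) j (suffix≢0⇒< L j nz))

  reduction-sound : ∀ X x → ∃ (λ n → reduction x n ⊆code X) → Derivable S (X ∪ ｛ x ｝) a
  reduction-sound X x (n , h) =
    let (check≢0 , u⊆X) = ⊆code-guard⁻ X (check x u L t) u h
    in Derivable-mono (Sum.map₁ (u⊆X _)) (check-sound x u t L check≢0)
    where
    u = unpair₁ n
    L = unpair₁ (unpair₂ n)
    t = unpair₂ (unpair₂ n)

  Accepted : ℕ → List ℕ → Set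
  Accepted t r = NZ (run e t (codeList r ∷ []))

  eventually-Accepted : ∀ {Z} rs → Valid S Z rs → Eventually (λ t → All (Accepted t) rs)
  eventually-Accepted []              _                = 0 , λ _ _ → []
  eventually-Accepted ((z ∷ ns) ∷ rs) ((s , _) , valid)
    with Equivalence.to (e-enumerates z ns) s
  ... | (y , halts) with eventually-× (run-complete halts) (eventually-Accepted rs valid)
  ... | (T , p) = T , λ t T≤t → let (runs , rest) = p t T≤t in (λ e′ → 1+n≢0 (trans (sym runs) e′)) ∷ rest

  codeRules : List (List ℕ) → ℕ
  codeRules rs = codeList (L.map codeList rs)

  suffix-codeRules : ∀ rs k → suffix (codeRules rs) k ≡ codeRules (drop k rs)
  suffix-codeRules rs k = trans (suffix-codeList (L.map codeList rs) k) (cong codeList (drop-map k rs))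

  module _ (x u t : ℕ) where

    premOK-complete : ∀ rs p → (Bits u ∪ ｛ x ｝) p ⊎ p ∈ conclusions rs → NZ (premOK x u p (codeRules rs))
    premOK-complete rs p (inj₁ (inj₁ in-u))  = orN⁺ˡ (bit p u) _ (≡1⇒NZ in-u)
    premOK-complete rs p (inj₁ (inj₂ refl))  = orN⁺ʳ (bit p u) _ (orN⁺ˡ (eqN p p) _ (≡1⇒NZ (eqN-refl p)))
    premOK-complete rs p (inj₂ concluded) with ∈-conclusions⇒drop rs concluded
    ... | (i , r , rs′ , dropped , concl , i<) =
      orN⁺ʳ (bit p u) _ (orN⁺ʳ (eqN x p) _ (anyBelow⁺ (codeRules rs) _ i i<code rule-i))
      where
      i<code : i < codeRules rs
      i<code = <-≤-trans i< (subst (_≤ codeRules rs) (length-map codeList rs) (length≤codeList (L.map codeList rs)))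
      rule-i : NZ (guard (suffix (codeRules rs) i) (eqN (hd (hd (suffix (codeRules rs) i))) p))
      rule-i rewrite suffix-codeRules rs i | dropped | hd-codeList (codeList r) (L.map codeList rs′)
                   | hd-codeList-conclusion r | concl | eqN-refl p = λ ()

    ifz-codeList : ∀ {rest} ds → (∀ q → q ∈ ds → NZ (premOK x u q rest)) →
                   NZ (ifz (codeList ds) 1 (premOK x u (hd (codeList ds)) rest))
    ifz-codeList []       h = λ ()
    ifz-codeList {rest} (q ∷ qs) h = subst (λ q′ → NZ (premOK x u q′ rest)) (sym (hd-codeList q qs)) (h q (here refl))

    stepOK-complete : ∀ r rs → Step S (Bits u ∪ ｛ x ｝) rs r → Accepted t r →
                      NZ (stepOK x u t (codeList (codeList r ∷ L.map codeList rs)))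
    stepOK-complete (z ∷ ns) rs (s , prem) accepted
      rewrite hd-codeList (codeList (z ∷ ns)) (L.map codeList rs) | tl-codeList (codeList (z ∷ ns)) (L.map codeList rs) =
      guard⁺ (codeList (z ∷ ns)) _ (λ ()) (guard⁺ (run e t (codeList (z ∷ ns) ∷ [])) _ accepted
                                         (allBelow⁺ (codeList (z ∷ ns)) _ premise))
      where
      premise : ∀ j → j < codeList (z ∷ ns) →
                NZ (ifz (suffix (tl (codeList (z ∷ ns))) j) 1
                        (premOK x u (hd (suffix (tl (codeList (z ∷ ns))) j)) (codeRules rs)))
      premise j _ rewrite tl-codeList z ns | suffix-codeList ns j =
        ifz-codeList {codeRules rs} (drop j ns) (λ q q∈ → premOK-complete rs q (All.lookup prem (∈-drop⇒∈ j ns q∈)))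

    check-complete : ∀ rs → Valid S (Bits u ∪ ｛ x ｝) rs → All (Accepted t) rs →
                     (Bits u ∪ ｛ x ｝) a ⊎ a ∈ conclusions rs → NZ (check x u (codeRules rs) t)
    check-complete rs valid accepted a-derived =
      guard⁺ _ _ (premOK-complete rs a a-derived) (allBelow⁺ (codeRules rs) _ step)
      where
      step : ∀ k → k < codeRules rs → NZ (ifz (suffix (codeRules rs) k) 1 (stepOK x u t (suffix (codeRules rs) k)))
      step k _ rewrite suffix-codeRules rs k with drop k rs in dropped
      ... | []       = λ ()
      ... | r ∷ rs′  = stepOK-complete r rs′ (Valid-drop k rs valid dropped)
                                       (All.lookup accepted (drop≡∷⇒∈ k rs dropped))

  reduction-complete : ExcludedMiddle 0ℓ → ∀ X x → Derivable S (X ∪ ｛ x ｝) a →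
                       ∃ λ n → reduction x n ⊆code X
  reduction-complete em X x d with linearize d
  ... | rs , valid , a-derived with eventually-Accepted rs valid | finite-subset-code em X (a ∷ allPremises rs)
  ... | T , accepted | u , u⊆X , X∩ps⊆u =
    pair u (pair (codeRules rs) T) ,
    subst (_⊆code X) (sym (reduction-pair x u (codeRules rs) T))
          (⊆code-guard⁺ X _ u (check-complete x u T rs valid′ (accepted T ≤-refl) a-derived′) u⊆X)
    where
    valid′ = Valid-mono rs (λ p∈ → Sum.map₁ (X∩ps⊆u _ (there p∈))) valid
    a-derived′ = Sum.map₁ (Sum.map₁ (X∩ps⊆u a (here refl))) a-derived

derivable-≤e : ExcludedMiddle 0ℓ → (S : SeqSet) → REseq S → (a : ℕ) (X : Pred ℕ 0ℓ) →
               (λ x → Derivable S (X ∪ ｛ x ｝) a) ≤e X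
derivable-≤e em S (e , e-enumerates) a X =
  reduction , reduction-computable , λ x → mk⇔ (reduction-complete em X x) (reduction-sound X x)
  where open Reduction S e e-enumerates a

≤e-resp-⇔ : ∀ {A B C : Pred ℕ 0ℓ} → (∀ x → A x ⇔ B x) → B ≤e C → A ≤e C
≤e-resp-⇔ A⇔B (f , f-computable , B⇔) = f , f-computable , λ x → B⇔ x ⇔-∘ A⇔B x

empty-≤e : ∀ {A B : Pred ℕ 0ℓ} → (∀ x → ¬ A x) → A ≤e B
empty-≤e ¬A = (λ _ _ → 0) , (zeroF , λ x n → evZero) , λ x → mk⇔ (λ Ax → ⊥-elim (¬A x Ax)) (λ { (_ , ()) })

mainTheorem4 : ExcludedMiddle 0ℓ → (S : SeqSet) → REseq S →
    (X : Pred ℕ 0ℓ) → Maximal S X → ∁ X ≤e X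
mainTheorem4 em S re X maximal with em {∃ (∁ X)}
... | no  ∁X-empty  = empty-≤e (λ x x∉X → ∁X-empty (x , x∉X))
... | yes (a , a∉X) = ≤e-resp-⇔ ∁X⇔derivable (derivable-≤e em S re a X)
  where
  ∁X⇔derivable : ∀ x → ∁ X x ⇔ Derivable S (X ∪ ｛ x ｝) a
  ∁X⇔derivable x = mk⇔ (λ x∉X → maximal⇒derivable maximal x∉X a) (derivable⇒∁ (proj₁ maximal) a∉X)
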